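{- Let $G$ be a graph, $K$ a clique of $G$, and $x$ a vertex not in $K$ such that either $x$ is a vertex of $G$ not adjacent to any vertex of $K$, or $x$ is a new vertex not in $G$; suppose that all vertices of $K$ have the same closed neighborhood in $G-x$. For $0\le i\le |K|$, let $G_i$ be the graph obtained from $G$ (together with $x$) by joining $x$ to exactly $i$ vertices of $K$. Then \[ (i-j)X_{G_k}+(j-k)X_{G_i}+(k-i)X_{G_j}=0\quad\text{for any } 0\le i\le j\le k\le |K|. \]
   Context: All graphs are finite simple graphs; $X_G=\sum_{\kappa}\prod_{v\in V(G)}x_{\kappa(v)}$ over proper colorings $\kappa:V(G)\to\{1,2,\dots\}$ is the chromatic symmetric function. A clique is a set of pairwise adjacent vertices. The closed neighborhood of a vertex $v$ is the set consisting of $v$ and all vertices adjacent to $v$. (Under the hypotheses, $X_{G_i}$ does not depend on which $i$ vertices of $K$ are chosen.) -}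

module Defs where

open import Data.Bool using (Bool; true; false; _∧_; _∨_; not)
open import Data.Nat using (ℕ; zero; suc; _≡ᵇ_)
open import Data.Fin using (Fin; zero; suc; _≟_)
open import Data.List using (List; []; _∷_; map; concatMap; allFin)
open import Relation.Nullary.Decidable using (⌊_⌋)
open import Relation.Binary.PropositionalEquality using (_≡_; _≢_; refl)

record SimpleGraph (n : ℕ) : Set where
  field
    adj        : Fin n → Fin n → Bool
    adj-sym    : ∀ u v → adj u v ≡ adj v u
    adj-irrefl : ∀ v → adj v v ≡ false
open SimpleGraph public

countB : {A : Set} → List A → (A → Bool) → ℕ
countB [] p = 0
countB (x ∷ xs) p with p x
... | true  = suc (countB xs p)
... | false = countB xs p

allB : {A : Set} → (A → Bool) → List A → Bool
allB p [] = true
allB p (x ∷ xs) = p x ∧ allB p xs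

VSet : ℕ → Set
VSet n = Fin n → Bool

size : {n : ℕ} → VSet n → ℕ
size {n} S = countB (allFin n) S

_⊆ᵛ_ : {n : ℕ} → VSet n → VSet n → Set
S ⊆ᵛ T = ∀ v → S v ≡ true → T v ≡ true

Disjoint : {n : ℕ} → VSet n → VSet n → Set
Disjoint S T = ∀ v → S v ≡ true → T v ≡ false

IsClique : {n : ℕ} → SimpleGraph n → VSet n → Set
IsClique G K = ∀ u v → K u ≡ true → K v ≡ true → u ≢ v → adj G u v ≡ true

closedNbr : {n : ℕ} → SimpleGraph n → Fin n → Fin n → Bool
closedNbr G u w = ⌊ u ≟ w ⌋ ∨ adj G u w

SameClosedNbr : {n : ℕ} → SimpleGraph n → VSet n → Set
SameClosedNbr G K = ∀ u v → K u ≡ true → K v ≡ true → ∀ w → closedNbr G u w ≡ closedNbr G v w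

private
  addAdj : {n : ℕ} → SimpleGraph n → VSet n → Fin (suc n) → Fin (suc n) → Bool
  addAdj G N zero zero = false
  addAdj G N zero (suc v) = N v
  addAdj G N (suc u) zero = N u
  addAdj G N (suc u) (suc v) = adj G u v

  addSym : {n : ℕ} (G : SimpleGraph n) (N : VSet n) → ∀ u v → addAdj G N u v ≡ addAdj G N v u
  addSym G N zero zero = refl
  addSym G N zero (suc v) = refl
  addSym G N (suc u) zero = refl
  addSym G N (suc u) (suc v) = adj-sym G u v

  addIrr : {n : ℕ} (G : SimpleGraph n) (N : VSet n) → ∀ v → addAdj G N v v ≡ false
  addIrr G N zero = refl
  addIrr G N (suc v) = adj-irrefl G v

addVertex : {n : ℕ} → SimpleGraph n → VSet n → SimpleGraph (suc n)
addVertex G N = record { adj = addAdj G N ; adj-sym = addSym G N ; adj-irrefl = addIrr G N }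

-- G−x = H, x's neighbours in H are S; join x additionally to the vertices in T
joinX : {n : ℕ} → SimpleGraph n → VSet n → VSet n → SimpleGraph (suc n)
joinX H S T = addVertex H (λ v → S v ∨ T v)

allFuns : (n m : ℕ) → List (Fin n → Fin m)
allFuns zero m = (λ ()) ∷ []
allFuns (suc n) m =
  concatMap (λ c → map (λ f → λ { zero → c ; (suc i) → f i }) (allFuns n m)) (allFin m)

isProper : {n m : ℕ} → SimpleGraph n → (Fin n → Fin m) → Bool
isProper {n} G κ =
  allB (λ u → allB (λ v → not (adj G u v) ∨ not ⌊ κ u ≟ κ v ⌋) (allFin n)) (allFin n)

hasType : {n m : ℕ} → (Fin n → Fin m) → (Fin m → ℕ) → Bool
hasType {n} {m} κ a = allB (λ c → countB (allFin n) (λ v → ⌊ κ v ≟ c ⌋) ≡ᵇ a c) (allFin m)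

-- Chromatic symmetric function X_G, given by its coefficients:
-- X[ G ] m a = coefficient of x_1^{a 0} ⋯ x_m^{a (m-1)} in X_G
-- = number of proper colourings κ with exactly a c vertices of colour c
-- (c ≤ m) and no vertex of colour > m.
X[_] : {n : ℕ} → SimpleGraph n → (m : ℕ) → (Fin m → ℕ) → ℕ
X[_] {n} G m a = countB (allFuns n m) (λ κ → isProper G κ ∧ hasType κ a)

-- Let G∅ be G with x joined only to its neighbours outside K, and for t ∈ K let N(t) count the
-- colourings of G∅ (of a fixed type) in which x and t have the same colour. A proper colouring of
-- G∅ stays proper in G_T unless x shares its colour with some t ∈ T, and as K is a clique there is
-- then exactly one such t; hence X_{G_T} = X_{G∅} − Σ_{t ∈ T} N(t). Transposing two vertices of K
-- is an automorphism of G∅ (they are closed twins there, since x sees neither), so N is constant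
-- on K and X_{G_T} = X_{G∅} − |T|·N is an affine function of |T|, which gives the relation.

module Submission where

open import Defs
open import Data.Bool using (Bool; true; false; _∧_; _∨_; not)
open import Data.Bool.Properties using (∨-zeroʳ)
import Data.Bool as Bool
open import Data.Fin using (Fin; zero; suc; _≟_)
open import Data.Fin.Permutation using (Permutation′; _⟨$⟩ʳ_; _⟨$⟩ˡ_; inverseˡ; inverseʳ; transpose)
open import Data.Fin.Properties using (suc-injective; any?)
open import Data.List using (List; []; _∷_; _++_; map; concatMap; allFin; tabulate)
open import Data.Nat as ℕ using (ℕ; _≤_; _≡ᵇ_)
open import Data.Product using (∃-syntax; _×_; _,_; proj₁; proj₂)
open import Function using (id; _∘_; flip)
open import Relation.Nullary using (yes; no; contradiction)
open import Relation.Unary using (Decidable)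
open import Relation.Nullary.Decidable using (⌊_⌋)
open import Relation.Binary.PropositionalEquality

module Sums where
  open import Data.Nat using (_+_; _*_)
  open import Data.Nat.Properties
    using (+-identityʳ; *-identityˡ; *-zeroʳ; +-assoc; *-distribˡ-+; *-distribʳ-+; +-commutativeSemigroup)
  open import Algebra.Properties.CommutativeSemigroup +-commutativeSemigroup using (interchange)

  private variable A B : Set

  𝟙[_] : Bool → ℕ
  𝟙[ true ] = 1
  𝟙[ false ] = 0

  𝟙-∧ : ∀ a b → 𝟙[ a ∧ b ] ≡ 𝟙[ a ] * 𝟙[ b ]
  𝟙-∧ true b = sym (+-identityʳ 𝟙[ b ])
  𝟙-∧ false b = refl

  ∑ : List A → (A → ℕ) → ℕ
  ∑ [] f = 0
  ∑ (x ∷ xs) f = f x + ∑ xs f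

  syntax ∑ L (λ x → e) = ∑[ x ∈ L ] e

  countB≡∑𝟙 : (L : List A) (p : A → Bool) → countB L p ≡ ∑[ x ∈ L ] 𝟙[ p x ]
  countB≡∑𝟙 [] p = refl
  countB≡∑𝟙 (x ∷ xs) p with p x
  ... | true = cong ℕ.suc (countB≡∑𝟙 xs p)
  ... | false = countB≡∑𝟙 xs p

  ∑-cong : (L : List A) {f g : A → ℕ} → (∀ x → f x ≡ g x) → ∑ L f ≡ ∑ L g
  ∑-cong [] f≗g = refl
  ∑-cong (x ∷ xs) f≗g = cong₂ _+_ (f≗g x) (∑-cong xs f≗g)

  ∑-zero : (L : List A) {f : A → ℕ} → (∀ x → f x ≡ 0) → ∑ L f ≡ 0
  ∑-zero [] f≗0 = refl
  ∑-zero (x ∷ xs) f≗0 = cong₂ _+_ (f≗0 x) (∑-zero xs f≗0)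

  ∑-+ : (L : List A) (f g : A → ℕ) → ∑[ x ∈ L ] (f x + g x) ≡ ∑ L f + ∑ L g
  ∑-+ [] f g = refl
  ∑-+ (x ∷ xs) f g =
    trans (cong (f x + g x +_) (∑-+ xs f g)) (interchange (f x) (g x) (∑ xs f) (∑ xs g))

  ∑-*ˡ : (L : List A) (c : ℕ) (f : A → ℕ) → ∑[ x ∈ L ] (c * f x) ≡ c * ∑ L f
  ∑-*ˡ [] c f = sym (*-zeroʳ c)
  ∑-*ˡ (x ∷ xs) c f =
    trans (cong (c * f x +_) (∑-*ˡ xs c f)) (sym (*-distribˡ-+ c (f x) (∑ xs f)))

  ∑-*ʳ : (L : List A) (c : ℕ) (f : A → ℕ) → ∑[ x ∈ L ] (f x * c) ≡ ∑ L f * c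
  ∑-*ʳ [] c f = refl
  ∑-*ʳ (x ∷ xs) c f =
    trans (cong (f x * c +_) (∑-*ʳ xs c f)) (sym (*-distribʳ-+ c (f x) (∑ xs f)))

  ∑-++ : (xs ys : List A) (f : A → ℕ) → ∑ (xs ++ ys) f ≡ ∑ xs f + ∑ ys f
  ∑-++ [] ys f = refl
  ∑-++ (x ∷ xs) ys f = trans (cong (f x +_) (∑-++ xs ys f)) (sym (+-assoc (f x) _ _))

  ∑-comm : (L : List A) (M : List B) (h : A → B → ℕ) →
    ∑[ x ∈ L ] ∑[ y ∈ M ] h x y ≡ ∑[ y ∈ M ] ∑[ x ∈ L ] h x y
  ∑-comm [] M h = sym (∑-zero M (λ _ → refl))
  ∑-comm (x ∷ xs) M h =
    trans (cong (∑ M (h x) +_) (∑-comm xs M h)) (sym (∑-+ M (h x) _))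

  ∑-map : (xs : List B) (g : B → A) (f : A → ℕ) → ∑ (map g xs) f ≡ ∑[ x ∈ xs ] f (g x)
  ∑-map [] g f = refl
  ∑-map (x ∷ xs) g f = cong (f (g x) +_) (∑-map xs g f)

  ∑-concatMap : (xs : List B) (F : B → List A) (f : A → ℕ) →
    ∑ (concatMap F xs) f ≡ ∑[ x ∈ xs ] ∑ (F x) f
  ∑-concatMap [] F f = refl
  ∑-concatMap (x ∷ xs) F f =
    trans (∑-++ (F x) (concatMap F xs) f) (cong (∑ (F x) f +_) (∑-concatMap xs F f))

  ∑-tabulate : ∀ {n} (g : Fin n → A) (f : A → ℕ) → ∑ (tabulate g) f ≡ ∑[ i ∈ allFin n ] f (g i)
  ∑-tabulate {n = ℕ.zero} g f = refl
  ∑-tabulate {n = ℕ.suc n} g f = cong (f (g zero) +_) (begin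
    ∑ (tabulate (g ∘ suc)) f                ≡⟨ ∑-tabulate (g ∘ suc) f ⟩
    ∑[ i ∈ allFin n ] f (g (suc i))          ≡⟨ ∑-tabulate suc (f ∘ g) ⟨
    ∑[ i ∈ tabulate {n = n} suc ] f (g i)    ∎)
    where open ≡-Reasoning

  ListsOnce : (A → A → Bool) → List A → Set
  ListsOnce _≈ᵇ_ L = ∀ y → ∑[ x ∈ L ] 𝟙[ x ≈ᵇ y ] ≡ 1

  module _ {_≈ᵇ_ : A → A → Bool} (L : List A) (once : ListsOnce _≈ᵇ_ L) where

    ∑-once-* : ∀ z c → ∑[ x ∈ L ] (𝟙[ x ≈ᵇ z ] * c) ≡ c
    ∑-once-* z c = trans (∑-*ʳ L c (λ x → 𝟙[ x ≈ᵇ z ])) (trans (cong (_* c) (once z)) (*-identityˡ c))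

    module _ (p : A → Bool) (p-resp : ∀ x y → x ≈ᵇ y ≡ true → p x ≡ p y) where

      ∑-select : ∀ z → ∑[ x ∈ L ] (𝟙[ x ≈ᵇ z ] * 𝟙[ p x ]) ≡ 𝟙[ p z ]
      ∑-select z = trans (∑-cong L replace) (∑-once-* z 𝟙[ p z ])
        where
        replace : ∀ x → 𝟙[ x ≈ᵇ z ] * 𝟙[ p x ] ≡ 𝟙[ x ≈ᵇ z ] * 𝟙[ p z ]
        replace x with x ≈ᵇ z in x≈z
        ... | true = cong (λ b → 1 * 𝟙[ b ]) (p-resp x z x≈z)
        ... | false = refl

      -- The last hypothesis says that f and g are mutually inverse up to _≈ᵇ_.
      ∑-reindex : (f g : A → A) → (∀ x y → (x ≈ᵇ f y) ≡ (y ≈ᵇ g x)) →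
        ∑[ y ∈ L ] 𝟙[ p (f y) ] ≡ ∑[ x ∈ L ] 𝟙[ p x ]
      ∑-reindex f g inverse = begin
        ∑[ y ∈ L ] 𝟙[ p (f y) ]                          ≡⟨ ∑-cong L (sym ∘ ∑-select ∘ f) ⟩
        ∑[ y ∈ L ] ∑[ x ∈ L ] (𝟙[ x ≈ᵇ f y ] * 𝟙[ p x ]) ≡⟨ ∑-comm L L _ ⟩
        ∑[ x ∈ L ] ∑[ y ∈ L ] (𝟙[ x ≈ᵇ f y ] * 𝟙[ p x ]) ≡⟨ ∑-cong L count-preimages ⟩
        ∑[ x ∈ L ] 𝟙[ p x ]                              ∎
        where
        open ≡-Reasoning
        count-preimages : ∀ x → ∑[ y ∈ L ] (𝟙[ x ≈ᵇ f y ] * 𝟙[ p x ]) ≡ 𝟙[ p x ]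
        count-preimages x =
          trans (∑-cong L (λ y → cong (λ b → 𝟙[ b ] * 𝟙[ p x ]) (inverse x y))) (∑-once-* (g x) 𝟙[ p x ])

open Sums

private variable n m : ℕ

true-iff⇒≡ : {a b : Bool} → (a ≡ true → b ≡ true) → (b ≡ true → a ≡ true) → a ≡ b
true-iff⇒≡ {true} a⇒b b⇒a = sym (a⇒b refl)
true-iff⇒≡ {false} {true} a⇒b b⇒a = b⇒a refl
true-iff⇒≡ {false} {false} a⇒b b⇒a = refl

∧-true : {a b : Bool} → a ∧ b ≡ true → a ≡ true × b ≡ true
∧-true {true} b≡true = refl , b≡true

≟⇒≡ : {i j : Fin n} → ⌊ i ≟ j ⌋ ≡ true → i ≡ j
≟⇒≡ {i = i} {j} _ with i ≟ j
... | yes i≡j = i≡j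

≡⇒≟ : {i j : Fin n} → i ≡ j → ⌊ i ≟ j ⌋ ≡ true
≡⇒≟ {i = i} {j} i≡j with i ≟ j
... | yes _ = refl
... | no i≢j = contradiction i≡j i≢j

≢⇒≟ : {i j : Fin n} → i ≢ j → ⌊ i ≟ j ⌋ ≡ false
≢⇒≟ {i = i} {j} i≢j with i ≟ j
... | yes i≡j = contradiction i≡j i≢j
... | no _ = refl

≟-sym : (i j : Fin n) → ⌊ i ≟ j ⌋ ≡ ⌊ j ≟ i ⌋
≟-sym i j = true-iff⇒≡ (≡⇒≟ ∘ sym ∘ ≟⇒≡) (≡⇒≟ ∘ sym ∘ ≟⇒≡)

≟-suc : (i j : Fin n) → ⌊ suc i ≟ suc j ⌋ ≡ ⌊ i ≟ j ⌋
≟-suc i j = true-iff⇒≡ (≡⇒≟ ∘ suc-injective ∘ ≟⇒≡) (≡⇒≟ ∘ cong suc ∘ ≟⇒≡)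

≟-∘-perm : (π : Permutation′ n) (i j : Fin n) → ⌊ π ⟨$⟩ʳ i ≟ π ⟨$⟩ʳ j ⌋ ≡ ⌊ i ≟ j ⌋
≟-∘-perm π i j = true-iff⇒≡ (≡⇒≟ ∘ injective ∘ ≟⇒≡) (≡⇒≟ ∘ cong (π ⟨$⟩ʳ_) ∘ ≟⇒≡)
  where
  injective : π ⟨$⟩ʳ i ≡ π ⟨$⟩ʳ j → i ≡ j
  injective πi≡πj = trans (sym (inverseˡ π)) (trans (cong (π ⟨$⟩ˡ_) πi≡πj) (inverseˡ π))

allFin-listsOnce : ListsOnce (λ i j → ⌊ i ≟ j ⌋) (allFin n)
allFin-listsOnce {n = ℕ.suc n} zero =
  cong ℕ.suc (trans (∑-tabulate {n = n} suc (λ i → 𝟙[ ⌊ i ≟ zero ⌋ ])) (∑-zero (allFin n) (λ _ → refl)))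
allFin-listsOnce {n = ℕ.suc n} (suc j) =
  trans (∑-tabulate {n = n} suc (λ i → 𝟙[ ⌊ i ≟ suc j ⌋ ]))
    (trans (∑-cong (allFin n) (cong 𝟙[_] ∘ flip ≟-suc j)) (allFin-listsOnce j))

_≗ᵇ_ : (f g : Fin n → Fin m) → Bool
_≗ᵇ_ {n = ℕ.zero} f g = true
_≗ᵇ_ {n = ℕ.suc n} f g = ⌊ f zero ≟ g zero ⌋ ∧ (f ∘ suc) ≗ᵇ (g ∘ suc)

≗ᵇ⇒≗ : {f g : Fin n → Fin m} → f ≗ᵇ g ≡ true → ∀ i → f i ≡ g i
≗ᵇ⇒≗ {n = ℕ.suc n} f≗ᵇg zero = ≟⇒≡ (proj₁ (∧-true f≗ᵇg))
≗ᵇ⇒≗ {n = ℕ.suc n} f≗ᵇg (suc i) = ≗ᵇ⇒≗ (proj₂ (∧-true f≗ᵇg)) i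

≗⇒≗ᵇ : {f g : Fin n → Fin m} → (∀ i → f i ≡ g i) → f ≗ᵇ g ≡ true
≗⇒≗ᵇ {n = ℕ.zero} f≗g = refl
≗⇒≗ᵇ {n = ℕ.suc n} f≗g rewrite ≡⇒≟ (f≗g zero) = ≗⇒≗ᵇ (f≗g ∘ suc)

allFuns-listsOnce : ListsOnce _≗ᵇ_ (allFuns n m)
allFuns-listsOnce {n = ℕ.zero} g = refl
allFuns-listsOnce {n = ℕ.suc n} {m} g = begin
  ∑[ f ∈ allFuns (ℕ.suc n) m ] 𝟙[ f ≗ᵇ g ]
    ≡⟨ ∑-concatMap (allFin m) _ _ ⟩
  ∑[ c ∈ allFin m ] ∑ (map _ (allFuns n m)) (λ f → 𝟙[ f ≗ᵇ g ])
    ≡⟨ ∑-cong (allFin m) (λ c → ∑-map (allFuns n m) _ _) ⟩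
  ∑[ c ∈ allFin m ] ∑[ f ∈ allFuns n m ] 𝟙[ ⌊ c ≟ g zero ⌋ ∧ f ≗ᵇ (g ∘ suc) ]
    ≡⟨ ∑-cong (allFin m) (λ c → count-tails ⌊ c ≟ g zero ⌋) ⟩
  ∑[ c ∈ allFin m ] 𝟙[ ⌊ c ≟ g zero ⌋ ]
    ≡⟨ allFin-listsOnce (g zero) ⟩
  1 ∎
  where
  open ≡-Reasoning
  count-tails : ∀ b → ∑[ f ∈ allFuns n m ] 𝟙[ b ∧ f ≗ᵇ (g ∘ suc) ] ≡ 𝟙[ b ]
  count-tails true = allFuns-listsOnce (g ∘ suc)
  count-tails false = ∑-zero (allFuns n m) (λ _ → refl)

module _ (π : Permutation′ n) where

  countB-∘-perm : (p : Fin n → Bool) → countB (allFin n) (p ∘ (π ⟨$⟩ʳ_)) ≡ countB (allFin n) p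
  countB-∘-perm p = begin
    countB (allFin n) (p ∘ (π ⟨$⟩ʳ_)) ≡⟨ countB≡∑𝟙 (allFin n) _ ⟩
    ∑[ i ∈ allFin n ] 𝟙[ p (π ⟨$⟩ʳ i) ] ≡⟨ ∑-reindex (allFin n) allFin-listsOnce p (λ i j → cong p ∘ ≟⇒≡)
                                            (π ⟨$⟩ʳ_) (π ⟨$⟩ˡ_) inverse ⟩
    ∑[ i ∈ allFin n ] 𝟙[ p i ]          ≡⟨ countB≡∑𝟙 (allFin n) p ⟨
    countB (allFin n) p                ∎
    where
    open ≡-Reasoning
    inverse : ∀ i j → ⌊ i ≟ π ⟨$⟩ʳ j ⌋ ≡ ⌊ j ≟ π ⟨$⟩ˡ i ⌋
    inverse i j = true-iff⇒≡
      (λ i≡πj → ≡⇒≟ (trans (sym (inverseˡ π)) (cong (π ⟨$⟩ˡ_) (sym (≟⇒≡ i≡πj)))))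
      (λ j≡π⁻¹i → ≡⇒≟ (trans (sym (inverseʳ π)) (cong (π ⟨$⟩ʳ_) (sym (≟⇒≡ j≡π⁻¹i)))))

  ∑-allFuns-∘-perm : {m : ℕ} (p : (Fin n → Fin m) → Bool) →
    (∀ κ κ′ → (∀ i → κ i ≡ κ′ i) → p κ ≡ p κ′) →
    ∑[ κ ∈ allFuns n m ] 𝟙[ p (κ ∘ (π ⟨$⟩ʳ_)) ] ≡ ∑[ κ ∈ allFuns n m ] 𝟙[ p κ ]
  ∑-allFuns-∘-perm {m} p p-resp =
    ∑-reindex (allFuns n m) allFuns-listsOnce p (λ κ κ′ → p-resp κ κ′ ∘ ≗ᵇ⇒≗)
    (_∘ (π ⟨$⟩ʳ_)) (_∘ (π ⟨$⟩ˡ_))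
    (λ κ κ′ → true-iff⇒≡
      (λ κ≗κ′π → ≗⇒≗ᵇ (λ i → trans (cong κ′ (sym (inverseʳ π))) (sym (≗ᵇ⇒≗ κ≗κ′π (π ⟨$⟩ˡ i)))))
      (λ κ′≗κπ⁻¹ → ≗⇒≗ᵇ (λ i → trans (cong κ (sym (inverseˡ π))) (sym (≗ᵇ⇒≗ κ′≗κπ⁻¹ (π ⟨$⟩ʳ i))))))

allB-cong : {A : Set} (L : List A) {p q : A → Bool} → (∀ x → p x ≡ q x) → allB p L ≡ allB q L
allB-cong [] p≗q = refl
allB-cong (x ∷ xs) p≗q = cong₂ _∧_ (p≗q x) (allB-cong xs p≗q)

allB-tabulate⁻ : {A : Set} {p : A → Bool} (g : Fin n → A) →
  allB p (tabulate g) ≡ true → ∀ i → p (g i) ≡ true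
allB-tabulate⁻ g all zero = proj₁ (∧-true all)
allB-tabulate⁻ g all (suc i) = allB-tabulate⁻ (g ∘ suc) (proj₂ (∧-true all)) i

allB-tabulate⁺ : {A : Set} {p : A → Bool} (g : Fin n → A) →
  (∀ i → p (g i) ≡ true) → allB p (tabulate g) ≡ true
allB-tabulate⁺ {n = ℕ.zero} g all = refl
allB-tabulate⁺ {n = ℕ.suc n} g all rewrite all zero = allB-tabulate⁺ (g ∘ suc) (all ∘ suc)

Proper : SimpleGraph n → (Fin n → Fin m) → Set
Proper G κ = ∀ u v → adj G u v ≡ true → κ u ≢ κ v

module _ (G : SimpleGraph n) {κ : Fin n → Fin m} where

  isProper⇒Proper : isProper G κ ≡ true → Proper G κ
  isProper⇒Proper proper u v uv κu≡κv = contradiction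
    (subst₂ (λ e c → not e ∨ not c ≡ true) uv (≡⇒≟ κu≡κv)
      (allB-tabulate⁻ id (allB-tabulate⁻ id proper u) v))
    λ ()

  Proper⇒isProper : Proper G κ → isProper G κ ≡ true
  Proper⇒isProper proper = allB-tabulate⁺ id λ u → allB-tabulate⁺ id λ v → edge-ok u v
    where
    edge-ok : ∀ u v → not (adj G u v) ∨ not ⌊ κ u ≟ κ v ⌋ ≡ true
    edge-ok u v with adj G u v in uv
    ... | false = refl
    ... | true rewrite ≢⇒≟ (proper u v uv) = refl

isProper-≡ : (G G′ : SimpleGraph n) {κ κ′ : Fin n → Fin m} →
  (Proper G κ → Proper G′ κ′) → (Proper G′ κ′ → Proper G κ) → isProper G κ ≡ isProper G′ κ′
isProper-≡ G G′ ⇒ ⇐ =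
  true-iff⇒≡ (Proper⇒isProper G′ ∘ ⇒ ∘ isProper⇒Proper G) (Proper⇒isProper G ∘ ⇐ ∘ isProper⇒Proper G′)

Proper-∘ : ∀ {n′} (G : SimpleGraph n) (G′ : SimpleGraph n′) {κ : Fin n′ → Fin m} (φ : Fin n → Fin n′) →
  (∀ u v → adj G u v ≡ true → adj G′ (φ u) (φ v) ≡ true) → Proper G′ κ → Proper G (κ ∘ φ)
Proper-∘ G G′ φ hom proper u v = proper (φ u) (φ v) ∘ hom u v

Proper-≗ : (G : SimpleGraph n) {κ κ′ : Fin n → Fin m} → (∀ v → κ v ≡ κ′ v) → Proper G κ → Proper G κ′
Proper-≗ G κ≗κ′ proper u v uv κ′u≡κ′v = proper u v uv (trans (κ≗κ′ u) (trans κ′u≡κ′v (sym (κ≗κ′ v))))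

Proper-clique-injective : {G : SimpleGraph n} {K : VSet n} {κ : Fin n → Fin m} →
  IsClique G K → Proper G κ →
  ∀ {u v} → K u ≡ true → K v ≡ true → κ u ≡ κ v → u ≡ v
Proper-clique-injective clique proper {u} {v} Ku Kv κu≡κv with u ≟ v
... | yes u≡v = u≡v
... | no u≢v = contradiction κu≡κv (proper u v (clique u v Ku Kv u≢v))

isProper-cong : (G : SimpleGraph n) {κ κ′ : Fin n → Fin m} → (∀ v → κ v ≡ κ′ v) →
  isProper G κ ≡ isProper G κ′
isProper-cong G κ≗κ′ = isProper-≡ G G (Proper-≗ G κ≗κ′) (Proper-≗ G (sym ∘ κ≗κ′))

isProper-∘-aut : (G : SimpleGraph n) (π : Permutation′ n) →
  (∀ u v → adj G (π ⟨$⟩ʳ u) (π ⟨$⟩ʳ v) ≡ adj G u v) →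
  (κ : Fin n → Fin m) → isProper G (κ ∘ (π ⟨$⟩ʳ_)) ≡ isProper G κ
isProper-∘-aut G π aut κ = isProper-≡ G G
  (Proper-≗ G (λ v → cong κ (inverseʳ π)) ∘ Proper-∘ G G (π ⟨$⟩ˡ_) π⁻¹-hom)
  (Proper-∘ G G (π ⟨$⟩ʳ_) (λ u v → trans (aut u v)))
  where
  π⁻¹-hom : ∀ u v → adj G u v ≡ true → adj G (π ⟨$⟩ˡ u) (π ⟨$⟩ˡ v) ≡ true
  π⁻¹-hom u v uv =
    trans (sym (aut _ _)) (subst₂ (λ u′ v′ → adj G u′ v′ ≡ true) (sym (inverseʳ π)) (sym (inverseʳ π)) uv)

countB-cong : {A : Set} (L : List A) {p q : A → Bool} → (∀ x → p x ≡ q x) → countB L p ≡ countB L q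
countB-cong L {p} {q} p≗q =
  trans (countB≡∑𝟙 L p) (trans (∑-cong L (cong 𝟙[_] ∘ p≗q)) (sym (countB≡∑𝟙 L q)))

hasType-∘-perm : (π : Permutation′ n) (κ : Fin n → Fin m) (a : Fin m → ℕ) →
  hasType (κ ∘ (π ⟨$⟩ʳ_)) a ≡ hasType κ a
hasType-∘-perm {m = m} π κ a =
  allB-cong (allFin m) (λ c → cong (_≡ᵇ a c) (countB-∘-perm π (λ v → ⌊ κ v ≟ c ⌋)))

hasType-cong : {κ κ′ : Fin n → Fin m} → (∀ v → κ v ≡ κ′ v) → (a : Fin m → ℕ) → hasType κ a ≡ hasType κ′ a
hasType-cong {n} {m} κ≗κ′ a = allB-cong (allFin m) (λ c → cong (_≡ᵇ a c)
  (countB-cong (allFin n) (λ v → cong (λ d → ⌊ d ≟ c ⌋) (κ≗κ′ v))))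

closedNbr-sym : (G : SimpleGraph n) (u w : Fin n) → closedNbr G u w ≡ closedNbr G w u
closedNbr-sym G u w = cong₂ _∨_ (≟-sym u w) (adj-sym G u w)

adj≡closedNbr : (G : SimpleGraph n) (u v : Fin n) → adj G u v ≡ not ⌊ u ≟ v ⌋ ∧ closedNbr G u v
adj≡closedNbr G u v with u ≟ v
... | yes refl = adj-irrefl G u
... | no _ = refl

closedTwins-aut : (G : SimpleGraph n) (π : Permutation′ n) →
  (∀ u w → closedNbr G (π ⟨$⟩ʳ u) w ≡ closedNbr G u w) →
  ∀ u v → adj G (π ⟨$⟩ʳ u) (π ⟨$⟩ʳ v) ≡ adj G u v
closedTwins-aut G π twin u v = begin
  adj G (π ⟨$⟩ʳ u) (π ⟨$⟩ʳ v)
    ≡⟨ adj≡closedNbr G _ _ ⟩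
  not ⌊ π ⟨$⟩ʳ u ≟ π ⟨$⟩ʳ v ⌋ ∧ closedNbr G (π ⟨$⟩ʳ u) (π ⟨$⟩ʳ v)
    ≡⟨ cong₂ (λ b c → not b ∧ c) (≟-∘-perm π u v) closed ⟩
  not ⌊ u ≟ v ⌋ ∧ closedNbr G u v
    ≡⟨ adj≡closedNbr G u v ⟨
  adj G u v
    ∎
  where
  open ≡-Reasoning
  closed : closedNbr G (π ⟨$⟩ʳ u) (π ⟨$⟩ʳ v) ≡ closedNbr G u v
  closed = begin
    closedNbr G (π ⟨$⟩ʳ u) (π ⟨$⟩ʳ v) ≡⟨ twin u _ ⟩
    closedNbr G u (π ⟨$⟩ʳ v)          ≡⟨ closedNbr-sym G u _ ⟩
    closedNbr G (π ⟨$⟩ʳ v) u          ≡⟨ twin v u ⟩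
    closedNbr G v u                  ≡⟨ closedNbr-sym G v u ⟩
    closedNbr G u v                  ∎

transpose-twins : (G : SimpleGraph n) {i j : Fin n} → (∀ w → closedNbr G i w ≡ closedNbr G j w) →
  ∀ k w → closedNbr G (transpose i j ⟨$⟩ʳ k) w ≡ closedNbr G k w
transpose-twins G {i} {j} i~j k w with k ≟ i
... | yes refl = sym (i~j w)
... | no _ with k ≟ j
...   | yes refl = i~j w
...   | no _ = refl

transpose-≡ : (i j : Fin n) → transpose i j ⟨$⟩ʳ i ≡ j
transpose-≡ i j with i ≟ i
... | yes _ = refl
... | no i≢i = contradiction refl i≢i

∅ : VSet n
∅ _ = false

module _ (H : SimpleGraph n) (S T : VSet n) {κ : Fin (ℕ.suc n) → Fin m} where

  joinX-∅-⊆ : ∀ u v → adj (joinX H S ∅) u v ≡ true → adj (joinX H S T) u v ≡ true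
  joinX-∅-⊆ zero (suc v) e with S v
  ... | true = refl
  joinX-∅-⊆ (suc u) zero e with S u
  ... | true = refl
  joinX-∅-⊆ (suc u) (suc v) e = e

  Proper-joinX⇒Proper-∅ : Proper (joinX H S T) κ → Proper (joinX H S ∅) κ
  Proper-joinX⇒Proper-∅ proper u v = proper u v ∘ joinX-∅-⊆ u v

  Proper-joinX⇒distinct : Proper (joinX H S T) κ → ∀ {t} → T t ≡ true → κ zero ≢ κ (suc t)
  Proper-joinX⇒distinct proper {t} Tt = proper zero (suc t) (trans (cong (S t ∨_) Tt) (∨-zeroʳ (S t)))

  Proper-∅⇒Proper-joinX : Proper (joinX H S ∅) κ → (∀ t → T t ≡ true → κ zero ≢ κ (suc t)) →
    Proper (joinX H S T) κ
  Proper-∅⇒Proper-joinX proper distinct zero (suc v) e with S v in Sv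
  ... | true = proper zero (suc v) (cong (_∨ false) Sv)
  ... | false = distinct v e
  Proper-∅⇒Proper-joinX proper distinct (suc u) zero e with S u in Su
  ... | true = proper (suc u) zero (cong (_∨ false) Su)
  ... | false = distinct u e ∘ sym
  Proper-∅⇒Proper-joinX proper distinct (suc u) (suc v) e = proper (suc u) (suc v) e

joinX-∅-closedTwins : (H : SimpleGraph n) {K S : VSet n} → Disjoint S K → SameClosedNbr H K →
  ∀ {t t′} → K t ≡ true → K t′ ≡ true →
  ∀ w → closedNbr (joinX H S ∅) (suc t) w ≡ closedNbr (joinX H S ∅) (suc t′) w
joinX-∅-closedTwins H {K} {S} disjoint twins {t} {t′} Kt Kt′ zero =
  cong (_∨ false) (trans (outside-S Kt) (sym (outside-S Kt′)))
  where
  outside-S : ∀ {v} → K v ≡ true → S v ≡ false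
  outside-S {v} Kv with S v in Sv
  ... | true = trans (sym Kv) (disjoint v Sv)
  ... | false = refl
joinX-∅-closedTwins H disjoint twins {t} {t′} Kt Kt′ (suc w) = begin
  ⌊ suc t ≟ suc w ⌋ ∨ adj H t w     ≡⟨ cong (_∨ adj H t w) (≟-suc t w) ⟩
  closedNbr H t w                  ≡⟨ twins t t′ Kt Kt′ w ⟩
  closedNbr H t′ w                 ≡⟨ cong (_∨ adj H t′ w) (≟-suc t′ w) ⟨
  ⌊ suc t′ ≟ suc w ⌋ ∨ adj H t′ w   ∎
  where open ≡-Reasoning

∃-constant-on : {P : Fin n → Set} → Decidable P → (f : Fin n → ℕ) →
  (∀ {t t′} → P t → P t′ → f t ≡ f t′) → ∃[ c ] (∀ {t} → P t → f t ≡ c)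
∃-constant-on P? f constant with any? P?
... | yes (t₀ , Pt₀) = f t₀ , λ Pt → constant Pt Pt₀
... | no ∄t = 0 , λ {t} Pt → contradiction (t , Pt) ∄t

module JoinToClique {n} (H : SimpleGraph n) (K S : VSet n)
  (clique : IsClique H K) (disjoint : Disjoint S K) (twins : SameClosedNbr H K)
  (m : ℕ) (a : Fin m → ℕ) where

  open import Data.Nat using (_+_; _*_)
  open import Data.Nat.Properties using (*-zeroʳ)

  G∅ : SimpleGraph (ℕ.suc n)
  G∅ = joinX H S ∅

  Colouring : Set
  Colouring = Fin (ℕ.suc n) → Fin m

  counted : SimpleGraph (ℕ.suc n) → Colouring → Bool
  counted G κ = isProper G κ ∧ hasType κ a

  x-coloured-like : Fin n → Colouring → Bool
  x-coloured-like t κ = ⌊ κ zero ≟ κ (suc t) ⌋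

  colourings : List Colouring
  colourings = allFuns (ℕ.suc n) m

  counted-sharing : Fin n → Colouring → Bool
  counted-sharing t κ = counted G∅ κ ∧ x-coloured-like t κ

  sharing : Fin n → ℕ
  sharing t = ∑[ κ ∈ colourings ] 𝟙[ counted-sharing t κ ]

  module _ {T : VSet n} (T⊆K : T ⊆ᵛ K) where

    Gᵀ : SimpleGraph (ℕ.suc n)
    Gᵀ = joinX H S T

    conflict : Colouring → Fin n → Bool
    conflict κ t = T t ∧ x-coloured-like t κ

    conflict-unique : ∀ {κ} → isProper G∅ κ ≡ true →
      ∀ {t t₀} → conflict κ t ≡ true → conflict κ t₀ ≡ true → t ≡ t₀
    conflict-unique {κ} proper c c₀ with ∧-true c | ∧-true c₀
    ... | Tt , κx≡κt | Tt₀ , κx≡κt₀ =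
      Proper-clique-injective {G = H} clique
        (Proper-∘ H G∅ suc (λ _ _ uv → uv) (isProper⇒Proper G∅ proper))
        (T⊆K _ Tt) (T⊆K _ Tt₀) (trans (sym (≟⇒≡ κx≡κt)) (≟⇒≡ κx≡κt₀))

    counted-ᵀ⇒counted-∅ : ∀ {κ} → counted Gᵀ κ ≡ true → counted G∅ κ ≡ true
    counted-ᵀ⇒counted-∅ {κ} c with ∧-true {isProper Gᵀ κ} c
    ... | properᵀ , typed =
      cong₂ _∧_ (Proper⇒isProper G∅ (Proper-joinX⇒Proper-∅ H S T (isProper⇒Proper Gᵀ properᵀ))) typed

    conflict⇒¬counted-ᵀ : ∀ {κ t} → conflict κ t ≡ true → counted Gᵀ κ ≡ false
    conflict⇒¬counted-ᵀ {κ} c with isProper Gᵀ κ in properᵀ | ∧-true c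
    ... | false | _ = refl
    ... | true | Tt , κx≡κt =
      contradiction (≟⇒≡ κx≡κt) (Proper-joinX⇒distinct H S T (isProper⇒Proper Gᵀ properᵀ) Tt)

    no-conflict⇒counted-ᵀ : ∀ {κ} → counted G∅ κ ≡ true → (∀ t → conflict κ t ≢ true) →
      counted Gᵀ κ ≡ true
    no-conflict⇒counted-ᵀ {κ} c none with ∧-true {isProper G∅ κ} c
    ... | proper∅ , typed = cong₂ _∧_ (Proper⇒isProper Gᵀ
      (Proper-∅⇒Proper-joinX H S T (isProper⇒Proper G∅ proper∅)
        λ t Tt κx≡κt → none t (trans (cong (_∧ x-coloured-like t κ) Tt) (≡⇒≟ κx≡κt)))) typed

    ∑-conflicts≡1 : ∀ {κ t₀} → isProper G∅ κ ≡ true → conflict κ t₀ ≡ true →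
      ∑[ t ∈ allFin n ] 𝟙[ conflict κ t ] ≡ 1
    ∑-conflicts≡1 {κ} {t₀} proper c₀ =
      trans (∑-cong (allFin n) (cong 𝟙[_] ∘ conflict≡≟)) (allFin-listsOnce t₀)
      where
      conflict≡≟ : ∀ t → conflict κ t ≡ ⌊ t ≟ t₀ ⌋
      conflict≡≟ t = true-iff⇒≡ (≡⇒≟ ∘ flip (conflict-unique proper) c₀)
                                (λ t≡t₀ → subst (λ s → conflict κ s ≡ true) (sym (≟⇒≡ t≡t₀)) c₀)

    ∑-conflicts≡0 : ∀ {κ} → (∀ t → conflict κ t ≢ true) → ∑[ t ∈ allFin n ] 𝟙[ conflict κ t ] ≡ 0
    ∑-conflicts≡0 {κ} none = ∑-zero (allFin n) no-conflict
      where
      no-conflict : ∀ t → 𝟙[ conflict κ t ] ≡ 0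
      no-conflict t with conflict κ t in c
      ... | true = contradiction c (none t)
      ... | false = refl

    ∑-conflicts : ∀ κ →
      ∑[ t ∈ allFin n ] 𝟙[ conflict κ t ] ≡ ∑[ t ∈ allFin n ] (𝟙[ T t ] * 𝟙[ x-coloured-like t κ ])
    ∑-conflicts κ = ∑-cong (allFin n) (λ t → 𝟙-∧ (T t) _)

    -- Since T is a clique, a colouring counted for G∅ gives x's colour to at most one vertex of T,
    -- and it is counted for Gᵀ exactly when it gives it to none.
    𝟙-counted-split : ∀ κ →
      𝟙[ counted G∅ κ ] ≡ 𝟙[ counted Gᵀ κ ] + ∑[ t ∈ allFin n ] (𝟙[ T t ] * 𝟙[ counted-sharing t κ ])
    𝟙-counted-split κ with counted G∅ κ in c∅ | counted Gᵀ κ in cᵀ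
                         | any? (λ t → conflict κ t Bool.≟ true)
    ... | false | false | _ = sym (∑-zero (allFin n) (λ t → *-zeroʳ 𝟙[ T t ]))
    ... | false | true  | _ = contradiction (trans (sym (counted-ᵀ⇒counted-∅ cᵀ)) c∅) λ ()
    ... | true  | true  | yes (_ , c₀) = contradiction (trans (sym cᵀ) (conflict⇒¬counted-ᵀ c₀)) λ ()
    ... | true  | false | no none =
      contradiction (trans (sym (no-conflict⇒counted-ᵀ c∅ (λ t → none ∘ (t ,_)))) cᵀ) λ ()
    ... | true  | false | yes (_ , c₀) =
      trans (sym (∑-conflicts≡1 (proj₁ (∧-true {isProper G∅ κ} c∅)) c₀)) (∑-conflicts κ)
    ... | true  | true  | no none =
      cong ℕ.suc (trans (sym (∑-conflicts≡0 {κ} (λ t → none ∘ (t ,_)))) (∑-conflicts κ))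

    X[G∅]≡X[Gᵀ]+∑ : X[ G∅ ] m a ≡ X[ Gᵀ ] m a + ∑[ t ∈ allFin n ] (𝟙[ T t ] * sharing t)
    X[G∅]≡X[Gᵀ]+∑ = begin
      X[ G∅ ] m a
        ≡⟨ countB≡∑𝟙 colourings (counted G∅) ⟩
      ∑[ κ ∈ colourings ] 𝟙[ counted G∅ κ ]
        ≡⟨ ∑-cong colourings 𝟙-counted-split ⟩
      ∑[ κ ∈ colourings ] (𝟙[ counted Gᵀ κ ] + ∑[ t ∈ allFin n ] (𝟙[ T t ] * 𝟙[ counted-sharing t κ ]))
        ≡⟨ ∑-+ colourings _ _ ⟩
      ∑[ κ ∈ colourings ] 𝟙[ counted Gᵀ κ ]
        + ∑[ κ ∈ colourings ] ∑[ t ∈ allFin n ] (𝟙[ T t ] * 𝟙[ counted-sharing t κ ])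
        ≡⟨ cong₂ _+_ (sym (countB≡∑𝟙 colourings _)) (∑-comm colourings (allFin n) _) ⟩
      X[ Gᵀ ] m a + ∑[ t ∈ allFin n ] ∑[ κ ∈ colourings ] (𝟙[ T t ] * 𝟙[ counted-sharing t κ ])
        ≡⟨ cong (X[ Gᵀ ] m a +_) (∑-cong (allFin n) (λ t → ∑-*ˡ colourings 𝟙[ T t ] _)) ⟩
      X[ Gᵀ ] m a + ∑[ t ∈ allFin n ] (𝟙[ T t ] * sharing t)
        ∎
      where open ≡-Reasoning

  sharing-on-K : ∀ {t t′} → K t ≡ true → K t′ ≡ true → sharing t′ ≡ sharing t
  sharing-on-K {t} {t′} Kt Kt′ = begin
    ∑[ κ ∈ colourings ] 𝟙[ counted-sharing t′ κ ]  ≡⟨ ∑-cong colourings (cong 𝟙[_] ∘ sym ∘ swapped) ⟩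
    ∑[ κ ∈ colourings ] 𝟙[ p (κ ∘ (π ⟨$⟩ʳ_)) ]     ≡⟨ ∑-allFuns-∘-perm π p p-resp ⟩
    ∑[ κ ∈ colourings ] 𝟙[ p κ ]                    ∎
    where
    open ≡-Reasoning
    π : Permutation′ (ℕ.suc n)
    π = transpose (suc t) (suc t′)

    p : Colouring → Bool
    p = counted-sharing t

    p-resp : ∀ κ κ′ → (∀ v → κ v ≡ κ′ v) → p κ ≡ p κ′
    p-resp κ κ′ κ≗κ′ = cong₂ _∧_ (cong₂ _∧_ (isProper-cong G∅ κ≗κ′) (hasType-cong κ≗κ′ a))
                                 (cong₂ (λ c d → ⌊ c ≟ d ⌋) (κ≗κ′ zero) (κ≗κ′ (suc t)))

    aut : ∀ u v → adj G∅ (π ⟨$⟩ʳ u) (π ⟨$⟩ʳ v) ≡ adj G∅ u v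
    aut = closedTwins-aut G∅ π (transpose-twins G∅ (joinX-∅-closedTwins H disjoint twins Kt Kt′))

    swapped : ∀ κ → p (κ ∘ (π ⟨$⟩ʳ_)) ≡ counted-sharing t′ κ
    swapped κ = cong₂ _∧_ (cong₂ _∧_ (isProper-∘-aut G∅ π aut κ) (hasType-∘-perm π κ a))
                          (cong (λ v → ⌊ κ zero ≟ κ v ⌋) (transpose-≡ (suc t) (suc t′)))

  sharing-constant-on-K : ∃[ N ] (∀ {t} → K t ≡ true → sharing t ≡ N)
  sharing-constant-on-K = ∃-constant-on (λ t → K t Bool.≟ true) sharing (λ Kt Kt′ → sharing-on-K Kt′ Kt)

  sharingOnK : ℕ
  sharingOnK = proj₁ sharing-constant-on-K

  ∑-sharing : {T : VSet n} → T ⊆ᵛ K → ∑[ t ∈ allFin n ] (𝟙[ T t ] * sharing t) ≡ size T * sharingOnK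
  ∑-sharing {T} T⊆K = begin
    ∑[ t ∈ allFin n ] (𝟙[ T t ] * sharing t)    ≡⟨ ∑-cong (allFin n) on-T ⟩
    ∑[ t ∈ allFin n ] (𝟙[ T t ] * sharingOnK)   ≡⟨ ∑-*ʳ (allFin n) sharingOnK (λ t → 𝟙[ T t ]) ⟩
    ∑[ t ∈ allFin n ] 𝟙[ T t ] * sharingOnK     ≡⟨ cong (_* sharingOnK) (countB≡∑𝟙 (allFin n) T) ⟨
    size T * sharingOnK                        ∎
    where
    open ≡-Reasoning
    on-T : ∀ t → 𝟙[ T t ] * sharing t ≡ 𝟙[ T t ] * sharingOnK
    on-T t with T t in Tt
    ... | true = cong (1 *_) (proj₂ sharing-constant-on-K (T⊆K t Tt))
    ... | false = refl

  X[joinX]+size*sharing≡X[G∅] : {T : VSet n} → T ⊆ᵛ K →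
    X[ joinX H S T ] m a + size T * sharingOnK ≡ X[ G∅ ] m a
  X[joinX]+size*sharing≡X[G∅] {T} T⊆K =
    sym (trans (X[G∅]≡X[Gᵀ]+∑ T⊆K) (cong (X[ joinX H S T ] m a +_) (∑-sharing T⊆K)))

open import Data.Integer using (ℤ; +_; _+_; _-_; _*_)
open import Data.Integer.Properties using (pos-+; pos-*)
open import Data.Integer.Tactic.RingSolver using (solve-∀)

collinear : ∀ (i j k N c xi xj xk : ℤ) → xi + i * N ≡ c → xj + j * N ≡ c → xk + k * N ≡ c →
  (i - j) * xk + (j - k) * xi + (k - i) * xj ≡ + 0
collinear i j k N c xi xj xk on-i on-j on-k = begin
  (i - j) * xk + (j - k) * xi + (k - i) * xj
    ≡⟨ shift i j k N xi xj xk ⟩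
  (i - j) * (xk + k * N) + (j - k) * (xi + i * N) + (k - i) * (xj + j * N)
    ≡⟨ cong₂ (λ yk yi → (i - j) * yk + (j - k) * yi + (k - i) * (xj + j * N)) on-k on-i ⟩
  (i - j) * c + (j - k) * c + (k - i) * (xj + j * N)
    ≡⟨ cong (λ yj → (i - j) * c + (j - k) * c + (k - i) * yj) on-j ⟩
  (i - j) * c + (j - k) * c + (k - i) * c
    ≡⟨ cancel i j k c ⟩
  + 0 ∎
  where
  open ≡-Reasoning
  shift : ∀ i j k N xi xj xk → (i - j) * xk + (j - k) * xi + (k - i) * xj
    ≡ (i - j) * (xk + k * N) + (j - k) * (xi + i * N) + (k - i) * (xj + j * N)
  shift = solve-∀
  cancel : ∀ i j k c → (i - j) * c + (j - k) * c + (k - i) * c ≡ + 0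
  cancel = solve-∀

corollary2p3 : {n : ℕ} (H : SimpleGraph n) (K S : VSet n)
    → IsClique H K → Disjoint S K → SameClosedNbr H K
    → (i j k : ℕ) → i ≤ j → j ≤ k
    → (Ti Tj Tk : VSet n)
    → Ti ⊆ᵛ K → size Ti ≡ i
    → Tj ⊆ᵛ K → size Tj ≡ j
    → Tk ⊆ᵛ K → size Tk ≡ k
    → (m : ℕ) (a : Fin m → ℕ)
    → (+ i - + j) * + X[ joinX H S Tk ] m a
    + (+ j - + k) * + X[ joinX H S Ti ] m a
    + (+ k - + i) * + X[ joinX H S Tj ] m a
    ≡ + 0
corollary2p3 H K S clique disjoint twins i j k _ _ Ti Tj Tk Ti⊆K |Ti| Tj⊆K |Tj| Tk⊆K |Tk| m a =
  collinear (+ i) (+ j) (+ k) (+ sharingOnK) (+ X[ G∅ ] m a) _ _ _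
    (on-line Ti⊆K |Ti|) (on-line Tj⊆K |Tj|) (on-line Tk⊆K |Tk|)
  where
  open JoinToClique H K S clique disjoint twins m a
  on-line : ∀ {T l} → T ⊆ᵛ K → size T ≡ l → + X[ joinX H S T ] m a + + l * + sharingOnK ≡ + X[ G∅ ] m a
  on-line {T} T⊆K refl = begin
    + X[ joinX H S T ] m a + + size T * + sharingOnK
      ≡⟨ cong (_+_ (+ X[ joinX H S T ] m a)) (pos-* (size T) sharingOnK) ⟨
    + X[ joinX H S T ] m a + + (size T ℕ.* sharingOnK)
      ≡⟨ pos-+ (X[ joinX H S T ] m a) _ ⟨
    + (X[ joinX H S T ] m a ℕ.+ size T ℕ.* sharingOnK)
      ≡⟨ cong +_ (X[joinX]+size*sharing≡X[G∅] T⊆K) ⟩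
    + X[ G∅ ] m a
      ∎
    where open ≡-Reasoning
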